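{- Let $r,M,N$ be positive integers. Then \[ \sum_{i=1}^{N}\frac{q^{2^i r}\,u_{2^{i+M}r-2^i r}}{w_{2^i r}\,w_{2^{i+M}r}}=\sum_{i=1}^{M}\frac{q^{2^i r}\,u_{2^{i+N}r-2^i r}}{w_{2^i r}\,w_{2^{i+N}r}}, \] and, for either choice of sign (the same on both sides), \[ \sum_{i=1}^{2N}\frac{(\pm1)^i q^{2^i r}\,u_{2^{i+2M}r-2^i r}}{w_{2^i r}\,w_{2^{i+2M}r}}=\sum_{i=1}^{2M}\frac{(\pm1)^i q^{2^i r}\,u_{2^{i+2N}r-2^i r}}{w_{2^i r}\,w_{2^{i+2N}r}}. \]
   Context: Let $a,b,p,q$ be complex numbers. The generalized Lucas sequence $w_n=w_n(a,b;p,q)$ is defined by $w_0=a$, $w_1=b$, $w_n=pw_{n-1}-qw_{n-2}$, and the Lucas sequence of the first kind is $u_n=u_n(p,q)=w_n(0,1;p,q)$. Let $\alpha,\beta$ be the roots of $x^2-px+q=0$, labeled so that $|\alpha|>|\beta|$, with discriminant $D=p^2-4q\neq 0$; thus $\alpha+\beta=p$, $\alpha\beta=q$, $\alpha-\beta=\sqrt D$. With $A=b-a\beta$, $B=b-a\alpha$, one has $w_n=(A\alpha^n-B\beta^n)/(\alpha-\beta)$ and $u_n=(\alpha^n-\beta^n)/(\alpha-\beta)$. As implicit in the statement, all denominators appearing are assumed nonzero. -}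

module Defs where

open import Level using (Level; _⊔_) renaming (suc to lsuc)
open import Data.Nat using (ℕ; zero; suc)
open import Relation.Nullary using (¬_)
open import Algebra.Bundles using (CommutativeRing)

-- A field: a commutative ring with 0 ≠ 1 and a (total) inverse function
-- which is a genuine multiplicative inverse on nonzero elements
-- (the value of 0⁻¹ is irrelevant; it is never used on a nonzero-hypothesis-free term).
record Field (c ℓ : Level) : Set (lsuc (c ⊔ ℓ)) where
  field
    commutativeRing : CommutativeRing c ℓ
  open CommutativeRing commutativeRing public
  field
    _⁻¹      : Carrier → Carrier
    ⁻¹-inverse : ∀ x → ¬ (x ≈ 0#) → x * (x ⁻¹) ≈ 1#
    0≉1      : ¬ (0# ≈ 1#)

  infixl 7 _/_
  _/_ : Carrier → Carrier → Carrier
  x / y = x * (y ⁻¹)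

module FieldDefs {c ℓ : Level} (F : Field c ℓ) where
  open Field F

  pow : Carrier → ℕ → Carrier
  pow x zero    = 1#
  pow x (suc n) = x * pow x n

  sum1 : ℕ → (ℕ → Carrier) → Carrier
  sum1 zero    f = 0#
  sum1 (suc n) f = sum1 n f + f (suc n)

  w : Carrier → Carrier → Carrier → Carrier → ℕ → Carrier
  w a b p q zero          = a
  w a b p q (suc zero)    = b
  w a b p q (suc (suc n)) = p * w a b p q (suc n) - q * w a b p q n

  u : Carrier → Carrier → ℕ → Carrier
  u p q = w 0# 1# p q

  disc : Carrier → Carrier → Carrier
  disc p q = p * p - (1# + 1# + 1# + 1#) * q

-- Write the left side as Σ_{i=1}^L T_K(i), with L = N, K = M and m(i) = 2^i r; the right side is Σ_{i=1}^K T_L(i).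
-- For a second solution Y = w(a',b';p,q) of the same recurrence, the Casoratian identity
--   w_m Y_n - w_n Y_m = (a b' - b a') q^m u_{n-m}   (m ≤ n)
-- turns (a b' - b a') times the i-th summand into the difference Y_{m(i+K)}/w_{m(i+K)} - Y_{m(i)}/w_{m(i)}.
-- Summing over 1 ≤ i ≤ L telescopes to Σ_{L+K} - Σ_K - Σ_L of these ratios, which is symmetric in K and L.
-- Taking Y = u (factor a) and Y = w(-1,0) (factor b), both a and b annihilate the difference of the two sides,
-- hence so does every w_k, and dividing by a nonvanishing w_{m(1)} gives the identity.
module Submission where

open import Defs
open import Data.Nat using (ℕ; zero; suc; _≤_; _∸_; NonZero; z≤n; s≤s; >-nonZero⁻¹)
  renaming (_+_ to _+ℕ_; _*_ to _*ℕ_; _^_ to _^ℕ_)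
import Data.Nat.Properties as ℕ
open import Data.Product using (_×_; _,_)
open import Data.Sum using (_⊎_; inj₁; inj₂)
open import Data.Maybe using (Maybe; just; nothing)
open import Data.Integer as ℤ using (ℤ; +_; -[1+_]; _⊖_)
open import Data.Integer.Base using (+-*-rawRing)
import Data.Integer.Properties as ℤ
open import Data.Sign as Sign using (Sign)
open import Algebra.Bundles using (CommutativeRing)
open import Algebra.Solver.Ring.AlmostCommutativeRing using (fromCommutativeRing; _-Raw-AlmostCommutative⟶_)
open import Relation.Nullary using (¬_; yes; no)
open import Relation.Binary.Definitions using (Monotonic₁)
import Relation.Binary.PropositionalEquality as ≡

-- With the ring's own elements as
-- coefficients (Tactic.RingSolver) a cancellation such as x - x ≈ 0# would need decidable equality in the ring.
module IntegerCoefficients {c ℓ} (R : CommutativeRing c ℓ) where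
  open CommutativeRing R
  open import Algebra.Properties.Ring ring using (-0#≈0#; -‿involutive; -‿distribˡ-*; -‿distribʳ-*; -‿+-comm)
  open import Algebra.Properties.AbelianGroup +-abelianGroup using (xyx⁻¹≈y)
  open import Algebra.Properties.Semiring.Mult semiring using (×-homo-+; ×1-homo-*) renaming (_×_ to _·_)
  open import Relation.Binary.Reasoning.Setoid setoid

  ⟦_⟧ : ℤ → Carrier
  ⟦ + n      ⟧ = n · 1#
  ⟦ -[1+ n ] ⟧ = - (suc n · 1#)

  signed : Sign → Carrier → Carrier
  signed Sign.+ x = x
  signed Sign.- x = - x

  signed-cong : ∀ s {x y} → x ≈ y → signed s x ≈ signed s y
  signed-cong Sign.+ x≈y = x≈y
  signed-cong Sign.- x≈y = -‿cong x≈y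

  signed-* : ∀ s t x y → signed (s Sign.* t) (x * y) ≈ signed s x * signed t y
  signed-* Sign.+ Sign.+ x y = refl
  signed-* Sign.+ Sign.- x y = -‿distribʳ-* x y
  signed-* Sign.- Sign.+ x y = -‿distribˡ-* x y
  signed-* Sign.- Sign.- x y = begin
    x * y          ≈⟨ -‿involutive (x * y) ⟨
    - - (x * y)    ≈⟨ -‿cong (-‿distribˡ-* x y) ⟩
    - (- x * y)    ≈⟨ -‿distribʳ-* (- x) y ⟩
    - x * - y      ∎

  ⟦◃⟧ : ∀ s n → ⟦ s ℤ.◃ n ⟧ ≈ signed s (n · 1#)
  ⟦◃⟧ Sign.+ zero    = refl
  ⟦◃⟧ Sign.- zero    = sym -0#≈0#
  ⟦◃⟧ Sign.+ (suc n) = refl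
  ⟦◃⟧ Sign.- (suc n) = refl

  ⟦sign◃∣∣⟧ : ∀ i → ⟦ i ⟧ ≈ signed (ℤ.sign i) (ℤ.∣ i ∣ · 1#)
  ⟦sign◃∣∣⟧ (+ n)      = refl
  ⟦sign◃∣∣⟧ -[1+ n ]   = refl

  ⟦⟧-homo-* : ∀ i j → ⟦ i ℤ.* j ⟧ ≈ ⟦ i ⟧ * ⟦ j ⟧
  ⟦⟧-homo-* i j = begin
    ⟦ i ℤ.* j ⟧                                 ≈⟨ ⟦◃⟧ (s Sign.* t) (∣i∣ *ℕ ∣j∣) ⟩
    signed (s Sign.* t) ((∣i∣ *ℕ ∣j∣) · 1#)     ≈⟨ signed-cong (s Sign.* t) (×1-homo-* ∣i∣ ∣j∣) ⟩
    signed (s Sign.* t) (∣i∣ · 1# * ∣j∣ · 1#)   ≈⟨ signed-* s t _ _ ⟩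
    signed s (∣i∣ · 1#) * signed t (∣j∣ · 1#)   ≈⟨ *-cong (⟦sign◃∣∣⟧ i) (⟦sign◃∣∣⟧ j) ⟨
    ⟦ i ⟧ * ⟦ j ⟧                               ∎
    where
    s t : Sign
    s = ℤ.sign i
    t = ℤ.sign j
    ∣i∣ ∣j∣ : ℕ
    ∣i∣ = ℤ.∣ i ∣
    ∣j∣ = ℤ.∣ j ∣

  ⟦⊖⟧ : ∀ m n → ⟦ m ⊖ n ⟧ ≈ m · 1# - n · 1#
  ⟦⊖⟧ m       zero    = sym (trans (+-congˡ -0#≈0#) (+-identityʳ _))
  ⟦⊖⟧ zero    (suc n) = sym (+-identityˡ _)
  ⟦⊖⟧ (suc m) (suc n) = begin
    ⟦ suc m ⊖ suc n ⟧                       ≡⟨ ≡.cong ⟦_⟧ (ℤ.[1+m]⊖[1+n]≡m⊖n m n) ⟩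
    ⟦ m ⊖ n ⟧                               ≈⟨ ⟦⊖⟧ m n ⟩
    m · 1# - n · 1#                         ≈⟨ x+y-[x+z]≈y-z 1# (m · 1#) (n · 1#) ⟨
    suc m · 1# - suc n · 1#                 ∎
    where
    x+y-[x+z]≈y-z : ∀ x y z → x + y - (x + z) ≈ y - z
    x+y-[x+z]≈y-z x y z = begin
      x + y - (x + z)       ≈⟨ +-congˡ (-‿+-comm x z) ⟨
      x + y + (- x + - z)   ≈⟨ +-assoc (x + y) (- x) (- z) ⟨
      x + y - x - z         ≈⟨ +-congʳ (xyx⁻¹≈y x y) ⟩
      y - z                 ∎

  ⟦⟧-homo-+ : ∀ i j → ⟦ i ℤ.+ j ⟧ ≈ ⟦ i ⟧ + ⟦ j ⟧
  ⟦⟧-homo-+ (+ m)    (+ n)      = ×-homo-+ 1# m n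
  ⟦⟧-homo-+ (+ m)    -[1+ n ]   = ⟦⊖⟧ m (suc n)
  ⟦⟧-homo-+ -[1+ m ] (+ n)      = trans (⟦⊖⟧ n (suc m)) (+-comm _ _)
  ⟦⟧-homo-+ -[1+ m ] -[1+ n ]   = begin
    - (suc (suc (m +ℕ n)) · 1#)         ≡⟨ ≡.cong (λ k → - (suc k · 1#)) (ℕ.+-suc m n) ⟨
    - ((suc m +ℕ suc n) · 1#)           ≈⟨ -‿cong (×-homo-+ 1# (suc m) (suc n)) ⟩
    - (suc m · 1# + suc n · 1#)          ≈⟨ -‿+-comm _ _ ⟨
    - (suc m · 1#) + - (suc n · 1#)      ∎

  ⟦⟧-homo-- : ∀ i → ⟦ ℤ.- i ⟧ ≈ - ⟦ i ⟧
  ⟦⟧-homo-- (+ zero)  = sym -0#≈0#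
  ⟦⟧-homo-- (+ suc n) = refl
  ⟦⟧-homo-- -[1+ n ]  = sym (-‿involutive _)

  homomorphism : +-*-rawRing -Raw-AlmostCommutative⟶ fromCommutativeRing R
  homomorphism = record
    { ⟦_⟧    = ⟦_⟧
    ; +-homo = ⟦⟧-homo-+
    ; *-homo = ⟦⟧-homo-*
    ; -‿homo = ⟦⟧-homo--
    ; 0-homo = refl
    ; 1-homo = +-identityʳ 1#
    }

  ⟦⟧-≟ : ∀ i j → Maybe (⟦ i ⟧ ≈ ⟦ j ⟧)
  ⟦⟧-≟ i j with i ℤ.≟ j
  ... | yes ≡.refl = just refl
  ... | no _       = nothing

  open import Algebra.Solver.Ring +-*-rawRing (fromCommutativeRing R) homomorphism ⟦⟧-≟ public
    using (solve; _:=_; _:+_; _:-_; _:*_)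

module LucasSums {o ℓ} (F : Field o ℓ) where
  open Field F
  open FieldDefs F
  open import Algebra.Properties.Ring ring using (-0#≈0#; -1*x≈-x; -‿involutive; -‿distribʳ-*)
  open import Relation.Binary.Reasoning.Setoid setoid
  open IntegerCoefficients commutativeRing using (solve; _:=_; _:+_; _:-_; _:*_)

  x+y≈z+w⇒x-w≈z-y : ∀ {x y z w} → x + y ≈ z + w → x - w ≈ z - y
  x+y≈z+w⇒x-w≈z-y {x} {y} {z} {w} x+y≈z+w = begin
    x - w             ≈⟨ solve 3 (λ x y w → x :- w := x :+ y :- (y :+ w)) refl x y w ⟩
    x + y - (y + w)   ≈⟨ +-congʳ x+y≈z+w ⟩
    z + w - (y + w)   ≈⟨ solve 3 (λ z w y → z :+ w :- (y :+ w) := z :- y) refl z w y ⟩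
    z - y             ∎

  pow-homo-* : ∀ x i j → pow x (i +ℕ j) ≈ pow x i * pow x j
  pow-homo-* x zero    j = sym (*-identityˡ _)
  pow-homo-* x (suc i) j = trans (*-congˡ (pow-homo-* x i j)) (sym (*-assoc x (pow x i) (pow x j)))

  pow-1# : ∀ n → pow 1# n ≈ 1#
  pow-1# zero    = refl
  pow-1# (suc n) = trans (*-identityˡ _) (pow-1# n)

  pow-even≈1# : ∀ n {σ} → σ * σ ≈ 1# → pow σ (2 *ℕ n) ≈ 1#
  pow-even≈1# zero    σ²≈1 = refl
  pow-even≈1# (suc n) {σ} σ²≈1 = begin
    pow σ (2 *ℕ suc n)            ≡⟨ ≡.cong (pow σ) (ℕ.*-suc 2 n) ⟩
    σ * (σ * pow σ (2 *ℕ n))      ≈⟨ sym (*-assoc σ σ _) ⟩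
    σ * σ * pow σ (2 *ℕ n)        ≈⟨ *-cong σ²≈1 (pow-even≈1# n σ²≈1) ⟩
    1# * 1#                       ≈⟨ *-identityˡ 1# ⟩
    1#                            ∎

  ±1-squared : ∀ {σ} → σ ≈ 1# ⊎ σ ≈ - 1# → σ * σ ≈ 1#
  ±1-squared (inj₁ σ≈1)  = trans (*-cong σ≈1 σ≈1) (*-identityˡ 1#)
  ±1-squared (inj₂ σ≈-1) = trans (*-cong σ≈-1 σ≈-1) (trans (-1*x≈-x (- 1#)) (-‿involutive 1#))

  ⁻¹-cancelˡ : ∀ {x} y → ¬ x ≈ 0# → x ⁻¹ * (x * y) ≈ y
  ⁻¹-cancelˡ {x} y x≉0 = begin
    x ⁻¹ * (x * y)   ≈⟨ solve 3 (λ x x' y → x' :* (x :* y) := x :* x' :* y) refl x (x ⁻¹) y ⟩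
    x * x ⁻¹ * y     ≈⟨ *-congʳ (⁻¹-inverse x x≉0) ⟩
    1# * y           ≈⟨ *-identityˡ y ⟩
    y                ∎

  *-cancelˡ : ∀ {x y z} → ¬ x ≈ 0# → x * y ≈ x * z → y ≈ z
  *-cancelˡ {x} {y} {z} x≉0 xy≈xz = begin
    y                ≈⟨ ⁻¹-cancelˡ y x≉0 ⟨
    x ⁻¹ * (x * y)   ≈⟨ *-congˡ xy≈xz ⟩
    x ⁻¹ * (x * z)   ≈⟨ ⁻¹-cancelˡ z x≉0 ⟩
    z                ∎

  *-≉0 : ∀ {x y} → ¬ x ≈ 0# → ¬ y ≈ 0# → ¬ x * y ≈ 0#
  *-≉0 x≉0 y≉0 xy≈0 = y≉0 (*-cancelˡ x≉0 (trans xy≈0 (sym (zeroʳ _))))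

  ⁻¹-distrib-* : ∀ {x y} → ¬ x ≈ 0# → ¬ y ≈ 0# → (x * y) ⁻¹ ≈ x ⁻¹ * y ⁻¹
  ⁻¹-distrib-* {x} {y} x≉0 y≉0 = *-cancelˡ (*-≉0 x≉0 y≉0) (begin
    x * y * (x * y) ⁻¹      ≈⟨ ⁻¹-inverse (x * y) (*-≉0 x≉0 y≉0) ⟩
    1#                      ≈⟨ *-identityˡ 1# ⟨
    1# * 1#                 ≈⟨ *-cong (⁻¹-inverse x x≉0) (⁻¹-inverse y y≉0) ⟨
    x * x ⁻¹ * (y * y ⁻¹)   ≈⟨ solve 4 (λ x x' y y' → x :* x' :* (y :* y') := x :* y :* (x' :* y'))
                                 refl x (x ⁻¹) y (y ⁻¹) ⟩
    x * y * (x ⁻¹ * y ⁻¹)   ∎)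

  [d*y-e*x]/[d*e]≈y/e-x/d : ∀ {d e} x y → ¬ d ≈ 0# → ¬ e ≈ 0# → (d * y - e * x) / (d * e) ≈ y / e - x / d
  [d*y-e*x]/[d*e]≈y/e-x/d {d} {e} x y d≉0 e≉0 = begin
    (d * y - e * x) * (d * e) ⁻¹                    ≈⟨ *-congˡ (⁻¹-distrib-* d≉0 e≉0) ⟩
    (d * y - e * x) * (d ⁻¹ * e ⁻¹)                 ≈⟨ solve 6 (λ d d' e e' x y →
                                                         (d :* y :- e :* x) :* (d' :* e')
                                                       := y :* (d :* d') :* e' :- x :* (e :* e') :* d')
                                                       refl d (d ⁻¹) e (e ⁻¹) x y ⟩
    y * (d * d ⁻¹) * e ⁻¹ - x * (e * e ⁻¹) * d ⁻¹   ≈⟨ +-cong (*-congʳ (cancel y d≉0))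
                                                               (-‿cong (*-congʳ (cancel x e≉0))) ⟩
    y * e ⁻¹ - x * d ⁻¹                             ∎
    where
    cancel : ∀ {z} y → ¬ z ≈ 0# → y * (z * z ⁻¹) ≈ y
    cancel {z} y z≉0 = trans (*-congˡ (⁻¹-inverse z z≉0)) (*-identityʳ y)

  sum1-cong : ∀ n {f g : ℕ → Carrier} → (∀ i → 1 ≤ i → i ≤ n → f i ≈ g i) → sum1 n f ≈ sum1 n g
  sum1-cong zero    f≈g = refl
  sum1-cong (suc n) f≈g =
    +-cong (sum1-cong n (λ i 1≤i i≤n → f≈g i 1≤i (ℕ.m≤n⇒m≤1+n i≤n))) (f≈g (suc n) (s≤s z≤n) ℕ.≤-refl)

  sum1-*-distribˡ : ∀ n x (f : ℕ → Carrier) → x * sum1 n f ≈ sum1 n (λ i → x * f i)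
  sum1-*-distribˡ zero    x f = zeroʳ x
  sum1-*-distribˡ (suc n) x f = trans (distribˡ x (sum1 n f) (f (suc n))) (+-congʳ (sum1-*-distribˡ n x f))

  sum1-sub : ∀ n (f g : ℕ → Carrier) → sum1 n (λ i → f i - g i) ≈ sum1 n f - sum1 n g
  sum1-sub zero    f g = sym (-‿inverseʳ 0#)
  sum1-sub (suc n) f g = trans (+-congʳ (sum1-sub n f g))
    (solve 4 (λ s t x y → s :- t :+ (x :- y) := s :+ x :- (t :+ y)) refl (sum1 n f) (sum1 n g) (f (suc n)) (g (suc n)))

  sum1-shift : ∀ K L (h : ℕ → Carrier) → sum1 L (λ i → h (i +ℕ K)) + sum1 K h ≈ sum1 (L +ℕ K) h
  sum1-shift K zero    h = +-identityˡ (sum1 K h)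
  sum1-shift K (suc L) h = trans
    (solve 3 (λ s x t → s :+ x :+ t := s :+ t :+ x) refl (sum1 L (λ i → h (i +ℕ K))) (h (suc L +ℕ K)) (sum1 K h))
    (+-congʳ (sum1-shift K L h))

  sum1-telescope-swap : ∀ K L (h : ℕ → Carrier) →
    sum1 L (λ i → h (i +ℕ K) - h i) ≈ sum1 K (λ i → h (i +ℕ L) - h i)
  sum1-telescope-swap K L h = begin
    sum1 L (λ i → h (i +ℕ K) - h i)         ≈⟨ sum1-sub L (λ i → h (i +ℕ K)) h ⟩
    sum1 L (λ i → h (i +ℕ K)) - sum1 L h    ≈⟨ x+y≈z+w⇒x-w≈z-y (begin
      sum1 L (λ i → h (i +ℕ K)) + sum1 K h    ≈⟨ sum1-shift K L h ⟩
      sum1 (L +ℕ K) h                         ≡⟨ ≡.cong (λ n → sum1 n h) (ℕ.+-comm L K) ⟩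
      sum1 (K +ℕ L) h                         ≈⟨ sum1-shift L K h ⟨
      sum1 K (λ i → h (i +ℕ L)) + sum1 L h    ∎) ⟩
    sum1 K (λ i → h (i +ℕ L)) - sum1 K h    ≈⟨ sum1-sub K (λ i → h (i +ℕ L)) h ⟨
    sum1 K (λ i → h (i +ℕ L) - h i)         ∎

  module _ (p q : Carrier) where

    casoratian : (X Y : ℕ → Carrier) → ℕ → Carrier
    casoratian X Y n = X n * Y (suc n) - X (suc n) * Y n

    casoratian-w : ∀ a b a' b' n → casoratian (w a b p q) (w a' b' p q) n ≈ pow q n * (a * b' - b * a')
    casoratian-w a b a' b' zero    = sym (*-identityˡ _)
    casoratian-w a b a' b' (suc n) = begin
      casoratian X Y (suc n)                ≈⟨ solve 6 (λ x₀ x₁ y₀ y₁ p q →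
                                                 x₁ :* (p :* y₁ :- q :* y₀) :- (p :* x₁ :- q :* x₀) :* y₁
                                               := q :* (x₀ :* y₁ :- x₁ :* y₀))
                                               refl (X n) (X (suc n)) (Y n) (Y (suc n)) p q ⟩
      q * casoratian X Y n                  ≈⟨ *-congˡ (casoratian-w a b a' b' n) ⟩
      q * (pow q n * (a * b' - b * a'))     ≈⟨ *-assoc q (pow q n) _ ⟨
      pow q (suc n) * (a * b' - b * a')     ∎
      where
      X Y : ℕ → Carrier
      X = w a b p q
      Y = w a' b' p q

    w-cross-difference : ∀ a b a' b' m d →
      w a b p q m * w a' b' p q (d +ℕ m) - w a b p q (d +ℕ m) * w a' b' p q m
        ≈ casoratian (w a b p q) (w a' b' p q) m * u p q d
    w-cross-difference a b a' b' m zero          = trans (-‿inverseʳ _) (sym (zeroʳ _))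
    w-cross-difference a b a' b' m (suc zero)    = sym (*-identityʳ _)
    w-cross-difference a b a' b' m (suc (suc d)) = begin
      X m * Y (2 +ℕ d +ℕ m) - X (2 +ℕ d +ℕ m) * Y m
        ≈⟨ solve 8 (λ x y x₁ x₀ y₁ y₀ p q →
               x :* (p :* y₁ :- q :* y₀) :- (p :* x₁ :- q :* x₀) :* y
             := p :* (x :* y₁ :- x₁ :* y) :- q :* (x :* y₀ :- x₀ :* y))
             refl (X m) (Y m) (X (suc d +ℕ m)) (X (d +ℕ m)) (Y (suc d +ℕ m)) (Y (d +ℕ m)) p q ⟩
      p * (X m * Y (suc d +ℕ m) - X (suc d +ℕ m) * Y m) - q * (X m * Y (d +ℕ m) - X (d +ℕ m) * Y m)
        ≈⟨ +-cong (*-congˡ (w-cross-difference a b a' b' m (suc d)))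
                  (-‿cong (*-congˡ (w-cross-difference a b a' b' m d))) ⟩
      p * (C * u p q (suc d)) - q * (C * u p q d)
        ≈⟨ solve 5 (λ p q C u₁ u₀ → p :* (C :* u₁) :- q :* (C :* u₀) := C :* (p :* u₁ :- q :* u₀))
             refl p q C (u p q (suc d)) (u p q d) ⟩
      C * u p q (2 +ℕ d)
        ∎
      where
      X Y : ℕ → Carrier
      X = w a b p q
      Y = w a' b' p q
      C : Carrier
      C = casoratian X Y m

    w-cross-difference-≤ : ∀ a b a' b' {m n} → m ≤ n →
      w a b p q m * w a' b' p q n - w a b p q n * w a' b' p q m ≈ (a * b' - b * a') * (pow q m * u p q (n ∸ m))
    w-cross-difference-≤ a b a' b' {m} {n} m≤n = begin
      X m * Y n - X n * Y m
        ≡⟨ ≡.cong (λ k → X m * Y k - X k * Y m) (≡.sym (ℕ.m∸n+n≡m m≤n)) ⟩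
      X m * Y (n ∸ m +ℕ m) - X (n ∸ m +ℕ m) * Y m
        ≈⟨ w-cross-difference a b a' b' m (n ∸ m) ⟩
      casoratian X Y m * u p q (n ∸ m)
        ≈⟨ *-congʳ (casoratian-w a b a' b' m) ⟩
      pow q m * c * u p q (n ∸ m)
        ≈⟨ solve 3 (λ Q c U → Q :* c :* U := c :* (Q :* U)) refl (pow q m) c (u p q (n ∸ m)) ⟩
      c * (pow q m * u p q (n ∸ m))
        ∎
      where
      X Y : ℕ → Carrier
      X = w a b p q
      Y = w a' b' p q
      c : Carrier
      c = a * b' - b * a'

    w-*-cong : ∀ {a b x y} → a * x ≈ a * y → b * x ≈ b * y → ∀ n → w a b p q n * x ≈ w a b p q n * y
    w-*-cong ax≈ay bx≈by zero          = ax≈ay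
    w-*-cong ax≈ay bx≈by (suc zero)    = bx≈by
    w-*-cong {a} {b} {x} {y} ax≈ay bx≈by (suc (suc n)) = begin
      (p * W₁ - q * W₀) * x        ≈⟨ expand x ⟩
      p * (W₁ * x) - q * (W₀ * x)  ≈⟨ +-cong (*-congˡ (w-*-cong ax≈ay bx≈by (suc n)))
                                              (-‿cong (*-congˡ (w-*-cong ax≈ay bx≈by n))) ⟩
      p * (W₁ * y) - q * (W₀ * y)  ≈⟨ expand y ⟨
      (p * W₁ - q * W₀) * y        ∎
      where
      W₀ W₁ : Carrier
      W₀ = w a b p q n
      W₁ = w a b p q (suc n)
      expand : ∀ z → (p * W₁ - q * W₀) * z ≈ p * (W₁ * z) - q * (W₀ * z)
      expand z = solve 5 (λ p q W₁ W₀ z → (p :* W₁ :- q :* W₀) :* z := p :* (W₁ :* z) :- q :* (W₀ :* z))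
                   refl p q W₁ W₀ z

  module _ (a b p q : Carrier) (m : ℕ → ℕ) where

    lucasTerm : ℕ → ℕ → Carrier
    lucasTerm K i = pow q (m i) * u p q (m (i +ℕ K) ∸ m i) / (w a b p q (m i) * w a b p q (m (i +ℕ K)))

    signedLucasTerm : Carrier → ℕ → ℕ → Carrier
    signedLucasTerm σ K i =
      pow σ i * pow q (m i) * u p q (m (i +ℕ K) ∸ m i) / (w a b p q (m i) * w a b p q (m (i +ℕ K)))

    signedRatio : Carrier → Carrier → Carrier → ℕ → Carrier
    signedRatio a' b' σ i = pow σ i * (w a' b' p q (m i) / w a b p q (m i))

    NonVanishing : ℕ → Set ℓ
    NonVanishing n = ∀ k → 1 ≤ k → k ≤ n → ¬ (w a b p q (m k) ≈ 0#)

    signedLucasTerm-1# : ∀ K i → signedLucasTerm 1# K i ≈ lucasTerm K i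
    signedLucasTerm-1# K i = *-congʳ (*-congʳ (trans (*-congʳ (pow-1# i)) (*-identityˡ _)))

    signedLucasTerm-telescopes : ∀ a' b' σ K i → m i ≤ m (i +ℕ K) → pow σ K ≈ 1# →
      ¬ w a b p q (m i) ≈ 0# → ¬ w a b p q (m (i +ℕ K)) ≈ 0# →
      (a * b' - b * a') * signedLucasTerm σ K i ≈ signedRatio a' b' σ (i +ℕ K) - signedRatio a' b' σ i
    signedLucasTerm-telescopes a' b' σ K i mᵢ≤mⱼ σᴷ≈1 xᵢ≉0 xⱼ≉0 = begin
      c * (s * Q * U * d⁻¹)
        ≈⟨ solve 5 (λ c s Q U d⁻¹ → c :* (s :* Q :* U :* d⁻¹) := s :* (c :* (Q :* U)) :* d⁻¹) refl c s Q U d⁻¹ ⟩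
      s * (c * (Q * U)) * d⁻¹
        ≈⟨ *-congʳ (*-congˡ (w-cross-difference-≤ p q a b a' b' mᵢ≤mⱼ)) ⟨
      s * (xᵢ * yⱼ - xⱼ * yᵢ) * d⁻¹
        ≈⟨ *-congʳ (solve 5 (λ s xᵢ yⱼ xⱼ yᵢ → s :* (xᵢ :* yⱼ :- xⱼ :* yᵢ) := xᵢ :* (s :* yⱼ) :- xⱼ :* (s :* yᵢ))
                     refl s xᵢ yⱼ xⱼ yᵢ) ⟩
      (xᵢ * (s * yⱼ) - xⱼ * (s * yᵢ)) * d⁻¹
        ≈⟨ [d*y-e*x]/[d*e]≈y/e-x/d (s * yᵢ) (s * yⱼ) xᵢ≉0 xⱼ≉0 ⟩
      s * yⱼ / xⱼ - s * yᵢ / xᵢ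
        ≈⟨ +-cong (trans (*-assoc s yⱼ _) (*-congʳ (sym σⁱ⁺ᴷ≈σⁱ))) (-‿cong (*-assoc s yᵢ _)) ⟩
      signedRatio a' b' σ (i +ℕ K) - signedRatio a' b' σ i
        ∎
      where
      c s Q U d⁻¹ xᵢ xⱼ yᵢ yⱼ : Carrier
      c = a * b' - b * a'
      s = pow σ i
      Q = pow q (m i)
      U = u p q (m (i +ℕ K) ∸ m i)
      xᵢ = w a b p q (m i)
      xⱼ = w a b p q (m (i +ℕ K))
      yᵢ = w a' b' p q (m i)
      yⱼ = w a' b' p q (m (i +ℕ K))
      d⁻¹ = (xᵢ * xⱼ) ⁻¹
      σⁱ⁺ᴷ≈σⁱ : pow σ (i +ℕ K) ≈ s
      σⁱ⁺ᴷ≈σⁱ = trans (pow-homo-* σ i K) (trans (*-congˡ σᴷ≈1) (*-identityʳ s))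

    casoratian-*-sum-swap : Monotonic₁ _≤_ _≤_ m → ∀ a' b' σ K L → pow σ K ≈ 1# → pow σ L ≈ 1# →
      NonVanishing (L +ℕ K) →
      (a * b' - b * a') * sum1 L (signedLucasTerm σ K) ≈ (a * b' - b * a') * sum1 K (signedLucasTerm σ L)
    casoratian-*-sum-swap mono a' b' σ K L σᴷ≈1 σᴸ≈1 nonzero = begin
      c * sum1 L (signedLucasTerm σ K)                ≈⟨ sum1-*-distribˡ L c _ ⟩
      sum1 L (λ i → c * signedLucasTerm σ K i)        ≈⟨ sum1-cong L (telescopes K L σᴷ≈1 nonzero) ⟩
      sum1 L (λ i → h (i +ℕ K) - h i)                 ≈⟨ sum1-telescope-swap K L h ⟩
      sum1 K (λ i → h (i +ℕ L) - h i)                 ≈⟨ sum1-cong K (telescopes L K σᴸ≈1 nonzero′) ⟨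
      sum1 K (λ i → c * signedLucasTerm σ L i)        ≈⟨ sum1-*-distribˡ K c _ ⟨
      c * sum1 K (signedLucasTerm σ L)                ∎
      where
      c : Carrier
      c = a * b' - b * a'
      h : ℕ → Carrier
      h = signedRatio a' b' σ
      nonzero′ : NonVanishing (K +ℕ L)
      nonzero′ k 1≤k k≤K+L = nonzero k 1≤k (≡.subst (k ≤_) (ℕ.+-comm K L) k≤K+L)
      telescopes : ∀ K L → pow σ K ≈ 1# → NonVanishing (L +ℕ K) →
                   ∀ i → 1 ≤ i → i ≤ L → c * signedLucasTerm σ K i ≈ h (i +ℕ K) - h i
      telescopes K L σᴷ≈1 nz i 1≤i i≤L = signedLucasTerm-telescopes a' b' σ K i (mono (ℕ.m≤m+n i K)) σᴷ≈1
        (nz i 1≤i (ℕ.≤-trans i≤L (ℕ.m≤m+n L K)))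
        (nz (i +ℕ K) (ℕ.≤-trans 1≤i (ℕ.m≤m+n i K)) (ℕ.+-monoˡ-≤ K i≤L))

    signed-lucas-sum-swap : Monotonic₁ _≤_ _≤_ m → ∀ σ K L → pow σ K ≈ 1# → pow σ L ≈ 1# → 1 ≤ L →
      NonVanishing (L +ℕ K) → sum1 L (signedLucasTerm σ K) ≈ sum1 K (signedLucasTerm σ L)
    signed-lucas-sum-swap mono σ K L σᴷ≈1 σᴸ≈1 1≤L nonzero =
      *-cancelˡ (nonzero 1 ℕ.≤-refl (ℕ.≤-trans 1≤L (ℕ.m≤m+n L K)))
        (w-*-cong p q (rescale a*1-b*0≈a (swap 0# 1#)) (rescale a*0-b*[-1]≈b (swap (- 1#) 0#)) (m 1))
      where
      swap : ∀ a' b' → (a * b' - b * a') * sum1 L (signedLucasTerm σ K)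
                     ≈ (a * b' - b * a') * sum1 K (signedLucasTerm σ L)
      swap a' b' = casoratian-*-sum-swap mono a' b' σ K L σᴷ≈1 σᴸ≈1 nonzero
      rescale : ∀ {c c' x y} → c ≈ c' → c * x ≈ c * y → c' * x ≈ c' * y
      rescale c≈c' cx≈cy = trans (*-congʳ (sym c≈c')) (trans cx≈cy (*-congʳ c≈c'))
      a*1-b*0≈a : a * 1# - b * 0# ≈ a
      a*1-b*0≈a = trans (+-cong (*-identityʳ a) (trans (-‿cong (zeroʳ b)) -0#≈0#)) (+-identityʳ a)
      a*0-b*[-1]≈b : a * 0# - b * - 1# ≈ b
      a*0-b*[-1]≈b = begin
        a * 0# - b * - 1#   ≈⟨ +-cong (zeroʳ a) (-‿cong (sym (-‿distribʳ-* b 1#))) ⟩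
        0# + - - (b * 1#)   ≈⟨ +-identityˡ _ ⟩
        - - (b * 1#)        ≈⟨ -‿involutive _ ⟩
        b * 1#              ≈⟨ *-identityʳ b ⟩
        b                   ∎

    lucas-sum-swap : Monotonic₁ _≤_ _≤_ m → ∀ K L → 1 ≤ L → NonVanishing (L +ℕ K) →
      sum1 L (lucasTerm K) ≈ sum1 K (lucasTerm L)
    lucas-sum-swap mono K L 1≤L nonzero = begin
      sum1 L (lucasTerm K)           ≈⟨ sum1-cong L (λ i _ _ → signedLucasTerm-1# K i) ⟨
      sum1 L (signedLucasTerm 1# K)  ≈⟨ signed-lucas-sum-swap mono 1# K L (pow-1# K) (pow-1# L) 1≤L nonzero ⟩
      sum1 K (signedLucasTerm 1# L)  ≈⟨ sum1-cong K (λ i _ _ → signedLucasTerm-1# L i) ⟩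
      sum1 K (lucasTerm L)           ∎

corollary13 : ∀ {c ℓ} (F : Field c ℓ) → let open Field F in let open FieldDefs F in
    ∀ (a b p q : Carrier) → ¬ (disc p q ≈ 0#) →
    ∀ (r M N : ℕ) → .{{NonZero r}} → .{{NonZero M}} → .{{NonZero N}} →
    ((∀ k → 1 ≤ k → k ≤ N +ℕ M → ¬ (w a b p q ((2 ^ℕ k) *ℕ r) ≈ 0#)) →
      sum1 N (λ i → pow q ((2 ^ℕ i) *ℕ r) * u p q ((2 ^ℕ (i +ℕ M)) *ℕ r ∸ (2 ^ℕ i) *ℕ r)
                    / (w a b p q ((2 ^ℕ i) *ℕ r) * w a b p q ((2 ^ℕ (i +ℕ M)) *ℕ r)))
      ≈ sum1 M (λ i → pow q ((2 ^ℕ i) *ℕ r) * u p q ((2 ^ℕ (i +ℕ N)) *ℕ r ∸ (2 ^ℕ i) *ℕ r)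
                    / (w a b p q ((2 ^ℕ i) *ℕ r) * w a b p q ((2 ^ℕ (i +ℕ N)) *ℕ r))))
    ×
    (∀ (σ : Carrier) → (σ ≈ 1# ⊎ σ ≈ - 1#) →
      (∀ k → 1 ≤ k → k ≤ 2 *ℕ N +ℕ 2 *ℕ M → ¬ (w a b p q ((2 ^ℕ k) *ℕ r) ≈ 0#)) →
      sum1 (2 *ℕ N) (λ i → pow σ i * pow q ((2 ^ℕ i) *ℕ r) * u p q ((2 ^ℕ (i +ℕ 2 *ℕ M)) *ℕ r ∸ (2 ^ℕ i) *ℕ r)
                    / (w a b p q ((2 ^ℕ i) *ℕ r) * w a b p q ((2 ^ℕ (i +ℕ 2 *ℕ M)) *ℕ r)))
      ≈ sum1 (2 *ℕ M) (λ i → pow σ i * pow q ((2 ^ℕ i) *ℕ r) * u p q ((2 ^ℕ (i +ℕ 2 *ℕ N)) *ℕ r ∸ (2 ^ℕ i) *ℕ r)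
                    / (w a b p q ((2 ^ℕ i) *ℕ r) * w a b p q ((2 ^ℕ (i +ℕ 2 *ℕ N)) *ℕ r))))
corollary13 F a b p q _ r M N =
    lucas-sum-swap a b p q m m-mono M N 1≤N
  , λ σ σ≈±1 → signed-lucas-sum-swap a b p q m m-mono σ (2 *ℕ M) (2 *ℕ N)
                 (pow-even≈1# M (±1-squared σ≈±1)) (pow-even≈1# N (±1-squared σ≈±1)) (ℕ.m≤n⇒m≤o*n 2 1≤N)
  where
  open LucasSums F
  m : ℕ → ℕ
  m i = 2 ^ℕ i *ℕ r
  m-mono : Monotonic₁ _≤_ _≤_ m
  m-mono i≤j = ℕ.*-monoˡ-≤ r (ℕ.^-monoʳ-≤ 2 i≤j)
  1≤N : 1 ≤ N
  1≤N = >-nonZero⁻¹ N
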